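{- For integers $m,n\ge1$, the $1$-shunt intersection graph of the bistar $S_{m,n}$ is isomorphic to $(K_m\cup K_n)+P_2$, the join of the disjoint union $K_m\cup K_n$ with the path $P_2$ on two vertices.
   Context: The bistar $S_{m,n}$ is obtained from the stars $K_{1,m}$ and $K_{1,n}$ by joining their centres with an edge. The join $H_1+H_2$ is the disjoint union of $H_1$ and $H_2$ together with all edges between $V(H_1)$ and $V(H_2)$. A $1$-arc of $G$ is an ordered pair $(u,v)$ with $uv\in E(G)$, written $uv$; it can be shunted onto the $1$-arc $vw$ if $w\neq u$ and $vw\in E(G)$. $A_1(G)$ has as vertices the $1$-arcs that can be shunted onto some other $1$-arc; two distinct vertices are adjacent iff the corresponding $1$-arcs share a vertex of $G$. -}

module Defs where

open import Level using (0ℓ)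
open import Data.Nat using (ℕ)
open import Data.Fin using (Fin)
open import Data.Sum using (_⊎_; inj₁; inj₂)
open import Data.Product using (Σ; Σ-syntax; ∃; ∃-syntax; _×_; _,_; proj₁)
open import Data.Empty using (⊥)
open import Data.Unit using (⊤)
open import Relation.Nullary using (¬_)
open import Relation.Binary.PropositionalEquality using (_≡_; _≢_)
open import Relation.Binary.PropositionalEquality using (isEquivalence)
open import Relation.Binary.Structures using (IsEquivalence)
open import Relation.Binary.Bundles using (Setoid)
open import Function.Bundles using (_⇔_; Inverse)
open import Data.Sum.Relation.Binary.Pointwise using (Pointwise; ⊎-isEquivalence)
import Data.Product.Relation.Binary.Pointwise.NonDependent
open Data.Product.Relation.Binary.Pointwise.NonDependent using (×-isEquivalence)
open import Function using (_on_)

record Graph : Set₁ where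
  field
    Vertex : Set
    _≈_    : Vertex → Vertex → Set
    ≈-equiv : IsEquivalence _≈_
    Adj    : Vertex → Vertex → Set
open Graph public

VSetoid : Graph → Setoid 0ℓ 0ℓ
VSetoid G = record { Carrier = Vertex G ; _≈_ = _≈_ G ; isEquivalence = ≈-equiv G }

_≅_ : Graph → Graph → Set
G ≅ H = Σ[ f ∈ Inverse (VSetoid G) (VSetoid H) ]
          (∀ u v → Adj G u v ⇔ Adj H (Inverse.to f u) (Inverse.to f v))

K : ℕ → Graph
K n = record { Vertex = Fin n ; _≈_ = _≡_ ; ≈-equiv = isEquivalence ; Adj = λ i j → i ≢ j }

P₂ : Graph
P₂ = K 2

_∪ᴳ_ : Graph → Graph → Graph
G ∪ᴳ H = record
  { Vertex = Vertex G ⊎ Vertex H ; _≈_ = Pointwise (_≈_ G) (_≈_ H)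
  ; ≈-equiv = ⊎-isEquivalence (≈-equiv G) (≈-equiv H) ; Adj = adj }
  where
  adj : Vertex G ⊎ Vertex H → Vertex G ⊎ Vertex H → Set
  adj (inj₁ a) (inj₁ b) = Adj G a b
  adj (inj₂ a) (inj₂ b) = Adj H a b
  adj _        _        = ⊥

_+ᴳ_ : Graph → Graph → Graph
G +ᴳ H = record
  { Vertex = Vertex G ⊎ Vertex H ; _≈_ = Pointwise (_≈_ G) (_≈_ H)
  ; ≈-equiv = ⊎-isEquivalence (≈-equiv G) (≈-equiv H) ; Adj = adj }
  where
  adj : Vertex G ⊎ Vertex H → Vertex G ⊎ Vertex H → Set
  adj (inj₁ a) (inj₁ b) = Adj G a b
  adj (inj₂ a) (inj₂ b) = Adj H a b
  adj _        _        = ⊤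

data BVertex (m n : ℕ) : Set where
  c₁ c₂ : BVertex m n
  leaf₁ : Fin m → BVertex m n
  leaf₂ : Fin n → BVertex m n

data BAdj {m n : ℕ} : BVertex m n → BVertex m n → Set where
  c₁c₂  : BAdj c₁ c₂
  c₂c₁  : BAdj c₂ c₁
  c₁l   : ∀ i → BAdj c₁ (leaf₁ i)
  lc₁   : ∀ i → BAdj (leaf₁ i) c₁
  c₂l   : ∀ j → BAdj c₂ (leaf₂ j)
  lc₂   : ∀ j → BAdj (leaf₂ j) c₂

Bistar : ℕ → ℕ → Graph
Bistar m n = record { Vertex = BVertex m n ; _≈_ = _≡_ ; ≈-equiv = isEquivalence ; Adj = BAdj }

Arc : Graph → Set
Arc G = Σ[ u ∈ Vertex G ] Σ[ v ∈ Vertex G ] Adj G u v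

Shuntable : (G : Graph) → Arc G → Set
Shuntable G (u , v , _) = ∃[ w ] (Adj G v w × ¬ (_≈_ G w u))

ShareVertex : (G : Graph) → Arc G → Arc G → Set
ShareVertex G (u , v , _) (u' , v' , _) =
  (_≈_ G u u') ⊎ (_≈_ G u v') ⊎ (_≈_ G v u') ⊎ (_≈_ G v v')

pair : (G : Graph) → Arc G → Vertex G × Vertex G
pair G (u , v , _) = u , v

_≈ᴬ_ : {G : Graph} → Arc G → Arc G → Set
_≈ᴬ_ {G} a b = Data.Product.Relation.Binary.Pointwise.NonDependent.Pointwise
                 (_≈_ G) (_≈_ G) (pair G a) (pair G b)

-- The 1-shunt intersection graph A₁(G): vertices are the shuntable 1-arcs,
-- identified when they are the same ordered pair (the shunting witness is
-- irrelevant); two distinct such arcs are adjacent iff they share a vertex.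
A₁ : Graph → Graph
A₁ G = record
  { Vertex  = Σ[ a ∈ Arc G ] Shuntable G a
  ; _≈_     = λ a b → _≈ᴬ_ {G} (proj₁ a) (proj₁ b)
  ; ≈-equiv = record
      { refl  = λ {a} → E.refl {pair G (proj₁ a)}
      ; sym   = λ {a} {b} → E.sym {pair G (proj₁ a)} {pair G (proj₁ b)}
      ; trans = λ {a} {b} {c} → E.trans {pair G (proj₁ a)} {pair G (proj₁ b)} {pair G (proj₁ c)}
      }
  ; Adj     = λ a b → ¬ (_≈ᴬ_ {G} (proj₁ a) (proj₁ b))
                      × ShareVertex G (proj₁ a) (proj₁ b)
  }
  where
  module E = IsEquivalence (×-isEquivalence {R = _≈_ G} {S = _≈_ G} (≈-equiv G) (≈-equiv G))

-- A 1-arc into a leaf cannot be shunted: the leaf's only neighbour is the arc's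
-- own tail. What remains are the m + n arcs from the leaves into their centres
-- and the two centre arcs c₁c₂ and c₂c₁, which are shuntable onto a leaf edge
-- precisely because m, n ≥ 1. Leaf arcs into the same centre all meet there and
-- form K_m and K_n, leaf arcs into different centres are disjoint, and each
-- centre arc contains both centres, so it meets every other shuntable arc: this
-- is the join with P₂.
module Submission where

open import Defs
open import Data.Nat using (ℕ; _≤_; suc)
open import Data.Fin using (Fin; zero; suc)
open import Data.Sum using (inj₁; inj₂)
import Data.Sum as Sum
open import Data.Product using (_,_; proj₁)
open import Data.Empty using (⊥-elim)
open import Data.Unit using (tt)
open import Relation.Nullary using (¬_)
open import Relation.Binary.PropositionalEquality using (_≡_; refl)
open import Relation.Binary.Bundles using (Setoid)
open import Function using (_∘_)
open import Function.Bundles using (_⇔_; Inverse; mk⇔)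
import Function.Properties.Equivalence as ⇔
open import Data.Sum.Relation.Binary.Pointwise using (inj₁; inj₂)

module _ (G : Graph) where
  open Setoid (VSetoid G) using (sym; trans)

  pendant-arc-not-shuntable : {u v : Vertex G} (e : Adj G u v) →
                              (∀ {w} → Adj G v w → _≈_ G w u) →
                              ¬ Shuntable G (u , v , e)
  pendant-arc-not-shuntable _ pendant (_ , e , w≉u) = w≉u (pendant e)

  ShareVertex-sym : {a b : Arc G} → ShareVertex G a b → ShareVertex G b a
  ShareVertex-sym {_ , _ , _} {_ , _ , _} (inj₁ p)               = inj₁ (sym p)
  ShareVertex-sym {_ , _ , _} {_ , _ , _} (inj₂ (inj₁ p))        = inj₂ (inj₂ (inj₁ (sym p)))
  ShareVertex-sym {_ , _ , _} {_ , _ , _} (inj₂ (inj₂ (inj₁ p))) = inj₂ (inj₁ (sym p))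
  ShareVertex-sym {_ , _ , _} {_ , _ , _} (inj₂ (inj₂ (inj₂ p))) = inj₂ (inj₂ (inj₂ (sym p)))

  ShareVertex-resp : {a a′ b b′ : Arc G} → _≈ᴬ_ {G} a a′ → _≈ᴬ_ {G} b b′ →
                     ShareVertex G a b → ShareVertex G a′ b′
  ShareVertex-resp {u , v , _} {u′ , v′ , _} {w , x , _} {w′ , x′ , _} (uu′ , vv′) (ww′ , xx′) =
    Sum.map (move u w uu′ ww′)
      (Sum.map (move u x uu′ xx′) (Sum.map (move v w vv′ ww′) (move v x vv′ xx′)))
    where
    move : ∀ p q {p′ q′} → _≈_ G p p′ → _≈_ G q q′ → _≈_ G p q → _≈_ G p′ q′
    move _ _ pp′ qq′ pq = trans (sym pp′) (trans pq qq′)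

  A₁-Adj-resp : {x x′ y y′ : Vertex (A₁ G)} →
                _≈_ (A₁ G) x x′ → _≈_ (A₁ G) y y′ → Adj (A₁ G) x y → Adj (A₁ G) x′ y′
  A₁-Adj-resp {x@(a , _)} {x′@(a′ , _)} {y@(b , _)} {y′@(b′ , _)} xx′ yy′ (x≉y , share) =
    (λ x′≈y′ → x≉y (A.trans {x} {x′} {y} xx′ (A.trans {x′} {y′} {y} x′≈y′ (A.sym {y} {y′} yy′))))
    , ShareVertex-resp {a} {a′} {b} {b′} xx′ yy′ share
    where module A = Setoid (VSetoid (A₁ G))

pattern tails-meet      = inj₁ refl
pattern tail-meets-head = inj₂ (inj₁ refl)
pattern heads-meet      = inj₂ (inj₂ (inj₂ refl))

module A₁-Bistar {m n : ℕ} where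

  S : Graph
  S = A₁ (Bistar m n)

  T : Graph
  T = (K m ∪ᴳ K n) +ᴳ P₂

  module Sᵛ = Setoid (VSetoid S)
  module Tᵛ = Setoid (VSetoid T)

  arc-into-leaf₁-not-shuntable : ∀ i → ¬ Shuntable (Bistar m n) (c₁ , leaf₁ i , c₁l i)
  arc-into-leaf₁-not-shuntable i =
    pendant-arc-not-shuntable (Bistar m n) (c₁l i) λ { (lc₁ _) → refl }

  arc-into-leaf₂-not-shuntable : ∀ j → ¬ Shuntable (Bistar m n) (c₂ , leaf₂ j , c₂l j)
  arc-into-leaf₂-not-shuntable j =
    pendant-arc-not-shuntable (Bistar m n) (c₂l j) λ { (lc₂ _) → refl }

  to : Vertex S → Vertex T
  to ((_ , _ , c₁c₂)  , _) = inj₂ zero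
  to ((_ , _ , c₂c₁)  , _) = inj₂ (suc zero)
  to ((_ , _ , lc₁ i) , _) = inj₁ (inj₁ i)
  to ((_ , _ , lc₂ j) , _) = inj₁ (inj₂ j)
  to ((_ , _ , c₁l i) , s) = ⊥-elim (arc-into-leaf₁-not-shuntable i s)
  to ((_ , _ , c₂l j) , s) = ⊥-elim (arc-into-leaf₂-not-shuntable j s)

  to-determined-by-pair : ∀ {u v} (e e′ : BAdj u v) s s′ →
                          to ((u , v , e) , s) ≡ to ((u , v , e′) , s′)
  to-determined-by-pair c₁c₂    c₁c₂     _ _ = refl
  to-determined-by-pair c₂c₁    c₂c₁     _ _ = refl
  to-determined-by-pair (lc₁ _) (lc₁ _)  _ _ = refl
  to-determined-by-pair (lc₂ _) (lc₂ _)  _ _ = refl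
  to-determined-by-pair (c₁l i) _        s _ = ⊥-elim (arc-into-leaf₁-not-shuntable i s)
  to-determined-by-pair (c₂l j) _        s _ = ⊥-elim (arc-into-leaf₂-not-shuntable j s)

  to-cong : ∀ {x y} → _≈_ S x y → _≈_ T (to x) (to y)
  to-cong {(_ , _ , e) , s} {(_ , _ , e′) , s′} (refl , refl) =
    Tᵛ.reflexive (to-determined-by-pair e e′ s s′)

  module _ (i₀ : Fin m) (j₀ : Fin n) where

    from : Vertex T → Vertex S
    from (inj₂ zero)       = (c₁ , c₂ , c₁c₂) , leaf₂ j₀ , c₂l j₀ , λ ()
    from (inj₂ (suc zero)) = (c₂ , c₁ , c₂c₁) , leaf₁ i₀ , c₁l i₀ , λ ()
    from (inj₁ (inj₁ i))   = (leaf₁ i , c₁ , lc₁ i) , c₂ , c₁c₂ , λ ()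
    from (inj₁ (inj₂ j))   = (leaf₂ j , c₂ , lc₂ j) , c₁ , c₂c₁ , λ ()

    arc : Vertex T → Arc (Bistar m n)
    arc = proj₁ ∘ from

    from-cong : ∀ {x y} → _≈_ T x y → _≈_ S (from x) (from y)
    from-cong (inj₁ (inj₁ refl)) = refl , refl
    from-cong (inj₁ (inj₂ refl)) = refl , refl
    from-cong (inj₂ refl)        = refl , refl

    to-from : ∀ x → _≈_ T (to (from x)) x
    to-from (inj₂ zero)       = Tᵛ.refl
    to-from (inj₂ (suc zero)) = Tᵛ.refl
    to-from (inj₁ (inj₁ _))   = Tᵛ.refl
    to-from (inj₁ (inj₂ _))   = Tᵛ.refl

    from-to : ∀ x → _≈_ S (from (to x)) x
    from-to ((_ , _ , c₁c₂)  , _) = refl , refl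
    from-to ((_ , _ , c₂c₁)  , _) = refl , refl
    from-to ((_ , _ , lc₁ _) , _) = refl , refl
    from-to ((_ , _ , lc₂ _) , _) = refl , refl
    from-to ((_ , _ , c₁l i) , s) = ⊥-elim (arc-into-leaf₁-not-shuntable i s)
    from-to ((_ , _ , c₂l j) , s) = ⊥-elim (arc-into-leaf₂-not-shuntable j s)

    iso : Inverse (VSetoid S) (VSetoid T)
    iso = record
      { to        = to
      ; from      = from
      ; to-cong   = λ {x} {y} → to-cong {x} {y}
      ; from-cong = from-cong
      ; inverse   = (λ {x} {y} y≈from-x → Tᵛ.trans (to-cong {y} {from x} y≈from-x) (to-from x))
                  , (λ {x} {y} y≈to-x →
                       Sᵛ.trans {from y} {from (to x)} {x} (from-cong y≈to-x) (from-to x))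
      }

    from-injective : ∀ {x y} → _≈_ S (from x) (from y) → _≈_ T x y
    from-injective {x} {y} p =
      Tᵛ.trans (Tᵛ.sym (to-from x)) (Tᵛ.trans (to-cong {from x} {from y} p) (to-from y))

    T-adj⇒≉ : ∀ {x y} → Adj T x y → ¬ _≈_ T x y
    T-adj⇒≉ i≢i (inj₁ (inj₁ refl)) = i≢i refl
    T-adj⇒≉ j≢j (inj₁ (inj₂ refl)) = j≢j refl
    T-adj⇒≉ p≢p (inj₂ refl)        = p≢p refl

    leaf-arcs-disjoint : ∀ i j →
                         ¬ ShareVertex (Bistar m n) (arc (inj₁ (inj₁ i))) (arc (inj₁ (inj₂ j)))
    leaf-arcs-disjoint i j (inj₁ ())
    leaf-arcs-disjoint i j (inj₂ (inj₁ ()))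
    leaf-arcs-disjoint i j (inj₂ (inj₂ (inj₁ ())))
    leaf-arcs-disjoint i j (inj₂ (inj₂ (inj₂ ())))

    centre-arc-meets : ∀ p x → ShareVertex (Bistar m n) (arc (inj₂ p)) (arc x)
    centre-arc-meets zero       (inj₂ zero)       = tails-meet
    centre-arc-meets zero       (inj₂ (suc zero)) = tail-meets-head
    centre-arc-meets zero       (inj₁ (inj₁ _))   = tail-meets-head
    centre-arc-meets zero       (inj₁ (inj₂ _))   = heads-meet
    centre-arc-meets (suc zero) (inj₂ zero)       = tail-meets-head
    centre-arc-meets (suc zero) (inj₂ (suc zero)) = tails-meet
    centre-arc-meets (suc zero) (inj₁ (inj₁ _))   = heads-meet
    centre-arc-meets (suc zero) (inj₁ (inj₂ _))   = tail-meets-head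

    T-adj⇒share : ∀ x y → Adj T x y → ShareVertex (Bistar m n) (arc x) (arc y)
    T-adj⇒share (inj₁ (inj₁ _)) (inj₁ (inj₁ _)) _  = heads-meet
    T-adj⇒share (inj₁ (inj₂ _)) (inj₁ (inj₂ _)) _  = heads-meet
    T-adj⇒share (inj₁ (inj₁ _)) (inj₁ (inj₂ _)) ()
    T-adj⇒share (inj₁ (inj₂ _)) (inj₁ (inj₁ _)) ()
    T-adj⇒share (inj₂ p)        y               _  = centre-arc-meets p y
    T-adj⇒share x               (inj₂ p)        _  =
      ShareVertex-sym (Bistar m n) {arc (inj₂ p)} {arc x} (centre-arc-meets p x)

    share⇒T-adj : ∀ x y → ¬ _≈_ T x y → ShareVertex (Bistar m n) (arc x) (arc y) → Adj T x y
    share⇒T-adj (inj₁ (inj₁ _)) (inj₁ (inj₁ _)) x≉y _     = λ e → x≉y (inj₁ (inj₁ e))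
    share⇒T-adj (inj₁ (inj₂ _)) (inj₁ (inj₂ _)) x≉y _     = λ e → x≉y (inj₁ (inj₂ e))
    share⇒T-adj (inj₁ (inj₁ i)) (inj₁ (inj₂ j)) _   share = leaf-arcs-disjoint i j share
    share⇒T-adj (inj₁ (inj₂ j)) (inj₁ (inj₁ i)) _   share =
      leaf-arcs-disjoint i j
        (ShareVertex-sym (Bistar m n) {arc (inj₁ (inj₂ j))} {arc (inj₁ (inj₁ i))} share)
    share⇒T-adj (inj₁ _)        (inj₂ _)        _   _     = tt
    share⇒T-adj (inj₂ _)        (inj₁ _)        _   _     = tt
    share⇒T-adj (inj₂ _)        (inj₂ _)        x≉y _     = λ e → x≉y (inj₂ e)

    from-adj : ∀ x y → Adj T x y ⇔ Adj S (from x) (from y)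
    from-adj x y = mk⇔
      (λ adj → T-adj⇒≉ {x} {y} adj ∘ from-injective , T-adj⇒share x y adj)
      (λ (from-x≉from-y , share) → share⇒T-adj x y (from-x≉from-y ∘ from-cong {x} {y}) share)

    to-adj : ∀ u v → Adj S u v ⇔ Adj T (to u) (to v)
    to-adj u v = ⇔.trans
      (mk⇔ (A₁-Adj-resp (Bistar m n) {u} {u′} {v} {v′}
                          (Sᵛ.sym {u′} {u} (from-to u)) (Sᵛ.sym {v′} {v} (from-to v)))
           (A₁-Adj-resp (Bistar m n) {u′} {u} {v′} {v} (from-to u) (from-to v)))
      (⇔.sym (from-adj (to u) (to v)))
      where
      u′ = from (to u)
      v′ = from (to v)

    A₁-Bistar≅ : A₁ (Bistar m n) ≅ ((K m ∪ᴳ K n) +ᴳ P₂)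
    A₁-Bistar≅ = iso , to-adj

mainTheorem12 : (m n : ℕ) → 1 ≤ m → 1 ≤ n →
    A₁ (Bistar m n) ≅ ((K m ∪ᴳ K n) +ᴳ P₂)
mainTheorem12 (suc m) (suc n) _ _ = A₁-Bistar.A₁-Bistar≅ zero zero
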